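{- Let $n \ge 1$, let $G \le S_n$ be a subgroup, let $p$ be a prime, and suppose $|G| = p^a$ for some positive integer $a$. Then the player can win the $(G, p)$-game.
   Context: For a set $S \subseteq S_n$ of permutations containing the identity and an integer $m \ge 1$, the $(S,m)$-game is: $n$ counters lie at positions $1, \dots, n$, each showing an element of $\mathbb{Z}_m$; the initial configuration in $\mathbb{Z}_m^n$ is arbitrary and unknown to the player (who is blindfolded and receives no information). Each turn the player makes a move $y \in \mathbb{Z}_m^n$, adding $y_i$ to the counter currently at position $i$; afterwards the counters are permuted by an arbitrary (adversarially chosen) permutation $g \in S$, the counter at position $x$ moving to position $g(x)$. A strategy is a fixed finite sequence of moves. The player "can win" if some finite sequence of moves guarantees that, for every initial configuration and every choice of the permutations, at some point (initially or after some move) all counters simultaneously show $0$. The $(G,p)$-game is this game with $S = G$ and $m = p$. -}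

module Defs where

open import Data.Nat using (ℕ; zero; suc; _+_)
open import Data.Nat.DivMod using (_mod_)
open import Data.Fin using (Fin; toℕ)
open import Data.Fin.Permutation using (Permutation′; _⟨$⟩ʳ_; _⟨$⟩ˡ_; _≈_; id; flip; _∘ₚ_)
open import Data.List using (List; []; _∷_; length)
open import Data.List.Relation.Unary.All using (All)
open import Data.List.Relation.Unary.Any using (Any)
open import Data.List.Relation.Unary.AllPairs using (AllPairs)
open import Data.Product using (Σ; _×_)
open import Data.Sum using (_⊎_)
open import Relation.Nullary using (¬_)
open import Relation.Binary.PropositionalEquality using (_≡_)

Zmod : ℕ → Set
Zmod m = Fin m

_+ₘ_ : {m : ℕ} → Zmod m → Zmod m → Zmod m
_+ₘ_ {zero} ()
_+ₘ_ {suc k} a b = (toℕ a + toℕ b) mod (suc k)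

record IsSubgroup {n : ℕ} (G : Permutation′ n → Set) : Set where
  field
    respects : ∀ {g h} → g ≈ h → G g → G h
    has-id   : G id
    closed-∘ : ∀ {g h} → G g → G h → G (g ∘ₚ h)
    closed-⁻¹ : ∀ {g} → G g → G (flip g)

HasOrder : {n : ℕ} → (Permutation′ n → Set) → ℕ → Set
HasOrder {n} G k =
  Σ (List (Permutation′ n)) λ gs →
    (length gs ≡ k)
    × All G gs
    × AllPairs (λ g h → ¬ (g ≈ h)) gs
    × (∀ g → G g → Any (λ h → g ≈ h) gs)

-- Configurations: the value shown by the counter at each position.
Config : ℕ → ℕ → Set
Config m n = Fin n → Zmod m

Move : ℕ → ℕ → Set
Move m n = Fin n → Zmod m

AllZero : {m n : ℕ} → Config m n → Set
AllZero c = ∀ i → toℕ (c i) ≡ 0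

applyMove : {m n : ℕ} → Config m n → Move m n → Config m n
applyMove c y i = c i +ₘ y i

-- Permute: the counter at position x moves to position g(x), so the new
-- configuration c' satisfies c' (g x) = c x, i.e. c' = c ∘ g⁻¹.
permute : {m n : ℕ} → Permutation′ n → Config m n → Config m n
permute g c i = c (g ⟨$⟩ˡ i)

-- Given initial configuration c, the move sequence, and the adversary's
-- permutations σ 0, σ 1, … (σ k applied after the (k+1)-th move),
-- all counters show 0 at some point (initially or after some move).
ZeroAtSomePoint : {m n : ℕ} → Config m n → List (Move m n) → (ℕ → Permutation′ n) → Set
ZeroAtSomePoint c [] σ = AllZero c
ZeroAtSomePoint c (y ∷ ys) σ =
  AllZero c ⊎ ZeroAtSomePoint (permute (σ 0) (applyMove c y)) ys (λ k → σ (suc k))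

CanWin : (n : ℕ) → (Permutation′ n → Set) → (m : ℕ) → Set
CanWin n S m =
  Σ (List (Move m n)) λ ys →
    ∀ (c : Config m n) (σ : ℕ → Permutation′ n) →
      (∀ k → S (σ k)) → ZeroAtSomePoint c ys σ

{-# OPTIONS --safe #-}
module Submission where

-- Configurations form the 𝔽_p-vector space V = 𝔽_p^n, on which G acts by permuting coordinates.
-- As G is a p-group, every G-invariant subspace W ≠ V admits v ∉ W with g v ≡ v (mod W) for all
-- g ∈ G: by orbit counting, the number of G-fixed points of V/W is ≡ |V/W| (mod p), and |V/W| is
-- divisible by p because 𝔽_p acts freely on V/W by translation along any u ∉ W; as 0 is fixed,
-- there are at least p fixed points. Iterating gives a flag 0 = W₀ ⊂ ⋯ ⊂ W_k = V of G-invariant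
-- subspaces with W_{i+1} = W_i + 𝔽_p v_i. A strategy S winning modulo W_{i+1} lifts to one winning
-- modulo W_i: play v_i p times before and after each move of S. Modulo W_{i+1} these blocks only
-- permute, so the lifted play is in W_{i+1} at the end of some block; then the configuration is
-- ≡ c v_i (mod W_i) at the start of that block, and during the block it runs through
-- c v_i, (c+1) v_i, …, hence through W_i. The empty strategy wins modulo W_k = V.

open import Defs
open import Data.Nat using (ℕ; suc; _≥_; _^_)
open import Data.Nat.Primality using (Prime)
open import Data.Fin.Permutation using (Permutation′) renaming (_≈_ to _≈ₚ_)
open import Data.List using (List; length)
open import Data.List.Relation.Unary.All using (All)
open import Data.List.Relation.Unary.Any using (Any)
open import Data.List.Relation.Unary.AllPairs using (AllPairs)
open import Data.Product using (_,_)
open import Relation.Binary.PropositionalEquality using (_≡_)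
open import Relation.Nullary using (¬_)

module ListCounting where

  open import Level using (Level)
  open import Algebra.Properties.CommutativeSemigroup using (interchange)
  open import Data.Nat using (_+_; _*_; _≤_; _<_; z≤n; s≤s)
  open import Data.Nat.Properties using (+-suc; +-commutativeSemigroup; *-zeroʳ; *-identityʳ; m≤n⇒m≤1+n)
  open import Data.Nat.ListAction using (sum)
  open import Data.List using ([]; _∷_; [_]; filter; map)
  open import Data.List.Properties
    using (map-cong; map-cong-local; filter-≐; filter-none; filter-++; length-++)
  open import Data.List.Relation.Unary.All using ([]; _∷_)
  import Data.List.Relation.Unary.All as All
  open import Data.List.Relation.Unary.All.Properties using (all-filter)
  open import Data.List.Relation.Unary.Any using (here; there)
  open import Data.List.Relation.Unary.AllPairs using (_∷_)
  open import Data.List.Relation.Unary.Enumerates.Setoid using (IsEnumeration)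
  open import Data.List.Relation.Unary.Unique.Setoid using (Unique)
  open import Data.List.Relation.Unary.Unique.Setoid.Properties using (filter⁺; Unique[x∷xs]⇒x∉xs)
  open import Data.List.Membership.Setoid.Properties using (∈-resp-≈; ∈-filter⁺)
  open import Data.Product using (_×_)
  open import Function using (_∘_)
  open import Function.Bundles using (Inverse)
  open import Relation.Binary.Bundles using (DecSetoid)
  open import Relation.Binary.Definitions using (_Respects_)
  open import Relation.Binary.PropositionalEquality as ≡ using (cong; cong₂)
  open import Relation.Nullary using (yes; no; contradiction)
  open import Relation.Nullary.Decidable using (¬?)
  open import Relation.Unary using (Pred; Decidable)

  private
    variable
      a p q : Level
      A : Set a

  sum-map-+ : ∀ (f g : A → ℕ) xs → sum (map (λ x → f x + g x) xs) ≡ sum (map f xs) + sum (map g xs)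
  sum-map-+ f g [] = ≡.refl
  sum-map-+ f g (x ∷ xs) rewrite sum-map-+ f g xs =
    interchange +-commutativeSemigroup (f x) (g x) (sum (map f xs)) (sum (map g xs))

  sum-map-const : ∀ c (xs : List A) → sum (map (λ _ → c) xs) ≡ length xs * c
  sum-map-const c [] = ≡.refl
  sum-map-const c (x ∷ xs) = cong (c +_) (sum-map-const c xs)

  module _ {P : Pred A p} (P? : Decidable P) where

    length-filter-∁ : ∀ xs → length xs ≡ length (filter P? xs) + length (filter (¬? ∘ P?) xs)
    length-filter-∁ [] = ≡.refl
    length-filter-∁ (x ∷ xs) with P? x
    ... | yes _ = cong suc (length-filter-∁ xs)
    ... | no _ = ≡.trans (cong suc (length-filter-∁ xs)) (≡.sym (+-suc _ _))

    length-filter-partition : ∀ {Q : Pred A q} (Q? : Decidable Q) xs →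
      length (filter Q? xs) ≡ length (filter Q? (filter P? xs)) + length (filter Q? (filter (¬? ∘ P?) xs))
    length-filter-partition Q? [] = ≡.refl
    length-filter-partition Q? (x ∷ xs) with P? x
    ... | yes _ with Q? x
    ...   | yes _ = cong suc (length-filter-partition Q? xs)
    ...   | no _ = length-filter-partition Q? xs
    length-filter-partition Q? (x ∷ xs) | no _ with Q? x
    ...   | yes _ = ≡.trans (cong suc (length-filter-partition Q? xs)) (≡.sym (+-suc _ _))
    ...   | no _ = length-filter-partition Q? xs

  module _ {P : Pred A p} {Q : Pred A q} (P? : Decidable P) (Q? : Decidable Q) (P⊆Q : ∀ {x} → P x → Q x) where

    length-filter-mono : ∀ xs → length (filter P? xs) ≤ length (filter Q? xs)
    length-filter-mono [] = z≤n
    length-filter-mono (x ∷ xs) with P? x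
    ... | yes Px with Q? x
    ...   | yes _ = s≤s (length-filter-mono xs)
    ...   | no ¬Qx = contradiction (P⊆Q Px) ¬Qx
    length-filter-mono (x ∷ xs) | no _ with Q? x
    ...   | yes _ = m≤n⇒m≤1+n (length-filter-mono xs)
    ...   | no _ = length-filter-mono xs

    length-filter-mono-< : ∀ {xs} → Any (λ x → Q x × ¬ P x) xs → length (filter P? xs) < length (filter Q? xs)
    length-filter-mono-< {x ∷ xs} x∈xs with P? x
    ... | yes Px with Q? x
    ...   | no ¬Qx = contradiction (P⊆Q Px) ¬Qx
    ...   | yes _ with x∈xs
    ...     | here (_ , ¬Px) = contradiction Px ¬Px
    ...     | there any = s≤s (length-filter-mono-< any)
    length-filter-mono-< {x ∷ xs} x∈xs | no _ with Q? x
    ...   | yes _ with x∈xs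
    ...     | here _ = s≤s (length-filter-mono xs)
    ...     | there any = m≤n⇒m≤1+n (length-filter-mono-< any)
    length-filter-mono-< {x ∷ xs} x∈xs | no _ | no ¬Qx with x∈xs
    ...     | here (Qx , _) = contradiction Qx ¬Qx
    ...     | there any = length-filter-mono-< any

  module _ {c ℓ} (S : DecSetoid c ℓ) where

    open DecSetoid S using (_≈_; _≟_; setoid; refl; sym; trans) renaming (Carrier to X)
    open import Data.List.Membership.Setoid setoid using (_∈_)

    length-filter-≈-unique : ∀ {x xs} → Unique setoid xs → x ∈ xs → length (filter (x ≟_) xs) ≡ 1
    length-filter-≈-unique {x} {y ∷ ys} (y∉ys ∷ _) (here x≈y) with x ≟ y
    ... | no x≉y = contradiction x≈y x≉y
    ... | yes _ = cong suc (cong length (filter-none (x ≟_) (All.map (λ y≉z x≈z → y≉z (trans (sym x≈y) x≈z)) y∉ys)))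
    length-filter-≈-unique {x} {y ∷ ys} (y∉ys ∷ ys!) (there x∈ys) with x ≟ y
    ... | no _ = length-filter-≈-unique ys! x∈ys
    ... | yes x≈y = contradiction (∈-resp-≈ setoid x≈y x∈ys) (Unique[x∷xs]⇒x∉xs setoid (y∉ys ∷ ys!))

    Unique∧2≤length⇒∃≉ : ∀ {xs} → Unique setoid xs → 2 ≤ length xs → ∀ z → Any (λ x → ¬ x ≈ z) xs
    Unique∧2≤length⇒∃≉ {_ ∷ []} _ (s≤s ()) _
    Unique∧2≤length⇒∃≉ {x ∷ y ∷ _} ((x≉y ∷ _) ∷ _) _ z with x ≟ z
    ... | no x≉z = here x≉z
    ... | yes x≈z = there (here (λ y≈z → x≉y (trans x≈z (sym y≈z))))

    module _ {A : Set a} (f : A → X) where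

      private
        fibre? : ∀ y → Decidable (λ g → f g ≈ y)
        fibre? y g = f g ≟ y

      sum-fibres-singleton : ∀ g ys → sum (map (λ y → length (filter (fibre? y) [ g ])) ys) ≡ length (filter (f g ≟_) ys)
      sum-fibres-singleton g [] = ≡.refl
      sum-fibres-singleton g (y ∷ ys) with f g ≟ y
      ... | yes _ = cong suc (sum-fibres-singleton g ys)
      ... | no _ = sum-fibres-singleton g ys

      sum-fibres : ∀ gs {ys} → Unique setoid ys → All (λ g → f g ∈ ys) gs →
                   sum (map (λ y → length (filter (fibre? y) gs)) ys) ≡ length gs
      sum-fibres [] {ys} _ _ = ≡.trans (sum-map-const 0 ys) (*-zeroʳ (length ys))
      sum-fibres (g ∷ gs) {ys} ys! (fg∈ys ∷ fgs∈ys) = begin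
        sum (map (λ y → length (filter (fibre? y) (g ∷ gs))) ys)
          ≡⟨ cong sum (map-cong split ys) ⟩
        sum (map (λ y → length (filter (fibre? y) [ g ]) + length (filter (fibre? y) gs)) ys)
          ≡⟨ sum-map-+ _ _ ys ⟩
        sum (map (λ y → length (filter (fibre? y) [ g ])) ys) + sum (map (λ y → length (filter (fibre? y) gs)) ys)
          ≡⟨ cong₂ _+_ (≡.trans (sum-fibres-singleton g ys) (length-filter-≈-unique ys! fg∈ys))
                       (sum-fibres gs ys! fgs∈ys) ⟩
        suc (length gs) ∎
        where
        open ≡.≡-Reasoning
        split : ∀ y → length (filter (fibre? y) (g ∷ gs)) ≡ length (filter (fibre? y) [ g ]) + length (filter (fibre? y) gs)
        split y = ≡.trans (cong length (filter-++ (fibre? y) [ g ] gs)) (length-++ (filter (fibre? y) [ g ]))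

    -- Count P ∘ φ along the fibres of φ over the elements satisfying P: each fibre is a singleton.
    length-filter-∘-inverse : ∀ {xs} → Unique setoid xs → IsEnumeration setoid xs → (φ : Inverse setoid setoid) →
      ∀ {P : Pred X p} (P? : Decidable P) → P Respects _≈_ →
      length (filter (P? ∘ Inverse.to φ) xs) ≡ length (filter P? xs)
    length-filter-∘-inverse {xs = xs} xs! xs-complete φ {P} P? P-resp = begin
      length (filter (P? ∘ to) xs)
        ≡⟨ sum-fibres to (filter (P? ∘ to) xs) (filter⁺ setoid P? xs!) (All.map to∈ (all-filter (P? ∘ to) xs)) ⟨
      sum (map (λ h → length (filter (λ g → to g ≟ h) (filter (P? ∘ to) xs))) (filter P? xs))
        ≡⟨ cong sum (map-cong-local (All.map single-preimage (all-filter P? xs))) ⟩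
      sum (map (λ _ → 1) (filter P? xs))
        ≡⟨ ≡.trans (sum-map-const 1 (filter P? xs)) (*-identityʳ _) ⟩
      length (filter P? xs) ∎
      where
      open ≡.≡-Reasoning
      open Inverse φ
      to∈ : ∀ {g} → P (to g) → to g ∈ filter P? xs
      to∈ {g} = ∈-filter⁺ setoid P? P-resp (xs-complete (to g))
      single-preimage : ∀ {h} → P h → length (filter (λ g → to g ≟ h) (filter (P? ∘ to) xs)) ≡ 1
      single-preimage {h} Ph = ≡.trans
        (cong length (filter-≐ (λ g → to g ≟ h) (from h ≟_)
          ((λ tg≈h → inverseʳ (sym tg≈h)) , λ fh≈g → inverseˡ (sym fh≈g)) (filter (P? ∘ to) xs)))
        (length-filter-≈-unique (filter⁺ setoid (P? ∘ to) xs!)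
          (∈-filter⁺ setoid (P? ∘ to) (P-resp ∘ to-cong) (xs-complete (from h)) (P-resp (sym (inverseˡ refl)) Ph)))

module PrimePowers where

  open import Data.Nat using (zero; _*_)
  open import Data.Nat.Properties using (*-comm; *-assoc; *-cancelˡ-≡)
  open import Data.Nat.Divisibility using (_∣_; divides; ∣1⇒≡1)
  open import Data.Nat.Primality using (euclidsLemma; prime⇒nonZero)
  open import Data.Sum using (_⊎_; inj₁; inj₂)
  open import Relation.Binary.PropositionalEquality using (refl; sym; trans; cong)

  ∣p^a⇒≡1⊎p∣ : ∀ {p d} → Prime p → ∀ a → d ∣ p ^ a → d ≡ 1 ⊎ p ∣ d
  ∣p^a⇒≡1⊎p∣ _ zero d∣1 = inj₁ (∣1⇒≡1 d∣1)
  ∣p^a⇒≡1⊎p∣ {p} {d} p-prime (suc a) (divides c p^[1+a]≡c*d)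
    with euclidsLemma c d p-prime (divides (p ^ a) (trans (sym p^[1+a]≡c*d) (*-comm p (p ^ a))))
  ... | inj₂ p∣d = inj₂ p∣d
  ... | inj₁ (divides c′ refl) = ∣p^a⇒≡1⊎p∣ p-prime a (divides c′ (*-cancelˡ-≡ (p ^ a) (c′ * d) p
          (trans p^[1+a]≡c*d (trans (cong (_* d) (*-comm c′ p)) (*-assoc p c′ d)))))
    where instance _ = prime⇒nonZero p-prime

module GroupActions where

  open import Level using (_⊔_)
  open import Algebra.Bundles using (Group)
  open import Data.Nat using (_*_; _<_)
  open import Data.Nat.Properties using (*-comm)
  open import Data.Nat.Divisibility using (_∣_; divides; _∣0; ∣m∣n⇒∣m+n)
  open import Data.Nat.Induction using (<-wellFounded)
  open import Data.Nat.ListAction using (sum)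
  open import Data.List using ([]; _∷_; filter; map)
  open import Data.List.Properties using (filter-all; filter-none; filter-notAll; filter-≐; map-cong-local)
  import Data.List.Relation.Unary.All as All
  open import Data.List.Relation.Unary.All.Properties using (all-filter)
  open import Data.List.Relation.Unary.Any using (here; any?)
  import Data.List.Relation.Unary.Any as Any
  open import Data.List.Relation.Unary.Enumerates.Setoid using (IsEnumeration)
  open import Data.List.Relation.Unary.Unique.Setoid using (Unique)
  open import Data.List.Relation.Unary.Unique.Setoid.Properties using (filter⁺)
  open import Data.List.Membership.Setoid.Properties using (∈-filter⁺; ∈-filter⁻)
  open import Data.Product using (∃-syntax; proj₂)
  open import Data.Sum using (inj₁; inj₂)
  open import Function using (_∘_)
  open import Function.Bundles using (Inverse)
  open import Induction.WellFounded using (Acc; acc)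
  open import Relation.Binary.Bundles using (Setoid; DecSetoid)
  open import Relation.Binary.Definitions using (_Respects_)
  import Relation.Binary.Definitions as B
  open import Relation.Binary.PropositionalEquality as ≡ using (_≢_; subst)
  import Relation.Binary.Reasoning.Setoid as ≈-Reasoning
  open import Relation.Nullary using (yes; no; contradiction)
  open import Relation.Nullary.Decidable using (¬?; map′)
  open import Relation.Unary using (Pred; Decidable)
  open ListCounting
  open PrimePowers

  record Action {g gℓ x xℓ} (𝔾 : Group g gℓ) (X : Setoid x xℓ) : Set (g ⊔ gℓ ⊔ x ⊔ xℓ) where
    private
      module 𝔾 = Group 𝔾
      module X = Setoid X
    infixr 5 _▷_
    field
      _▷_ : 𝔾.Carrier → X.Carrier → X.Carrier
      ▷-cong : ∀ {g h x y} → g 𝔾.≈ h → x X.≈ y → g ▷ x X.≈ h ▷ y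
      ε-▷ : ∀ x → 𝔾.ε ▷ x X.≈ x
      ∙-▷ : ∀ g h x → (g 𝔾.∙ h) ▷ x X.≈ g ▷ h ▷ x

    ⁻¹-▷ : ∀ g x → g 𝔾.⁻¹ ▷ g ▷ x X.≈ x
    ⁻¹-▷ g x = X.trans (X.sym (∙-▷ (g 𝔾.⁻¹) g x)) (X.trans (▷-cong (𝔾.inverseˡ g) X.refl) (ε-▷ x))

  left-multiplication : ∀ {g gℓ} (𝔾 : Group g gℓ) → Group.Carrier 𝔾 → Inverse (Group.setoid 𝔾) (Group.setoid 𝔾)
  left-multiplication 𝔾 h = record
    { to = h ∙_
    ; from = h \\_
    ; to-cong = ∙-congˡ
    ; from-cong = \\-cong₂ refl
    ; inverse = (λ {x} y≈h\\x → trans (∙-congˡ y≈h\\x) (\\-leftDividesˡ h x))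
              , (λ {x} y≈h∙x → trans (\\-cong₂ refl y≈h∙x) (\\-leftDividesʳ h x))
    }
    where
    open Group 𝔾
    open import Algebra.Properties.Group 𝔾 using (\\-cong₂; \\-leftDividesˡ; \\-leftDividesʳ)

  module FixedPoints {g gℓ x xℓ} {𝔾 : Group g gℓ} (_≟ᴳ_ : B.Decidable (Group._≈_ 𝔾))
    {gs : List (Group.Carrier 𝔾)} (gs! : Unique (Group.setoid 𝔾) gs) (gs-complete : IsEnumeration (Group.setoid 𝔾) gs)
    (X : DecSetoid x xℓ) (act : Action 𝔾 (DecSetoid.setoid X)) where

    private
      module 𝔾 = Group 𝔾
    open DecSetoid X using (_≈_; _≟_; refl; sym; trans; setoid) renaming (Carrier to A)
    open Action act
    open import Data.List.Membership.Setoid setoid using (_∈_)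

    Fixed : Pred A (g ⊔ xℓ)
    Fixed x = ∀ h → h ▷ x ≈ x

    fixed? : Decidable Fixed
    fixed? x = map′ (λ all h → All.lookupₛ 𝔾.setoid resp all (gs-complete h)) (λ fx → All.tabulate (λ {h} _ → fx h))
                    (All.all? (λ h → h ▷ x ≟ x) gs)
      where
      resp : (λ h → h ▷ x ≈ x) Respects 𝔾._≈_
      resp h≈k hx≈x = trans (▷-cong (𝔾.sym h≈k) refl) hx≈x

    Orbit : A → Pred A (g ⊔ xℓ)
    Orbit x y = ∃[ h ] h ▷ x ≈ y

    orbit? : ∀ x → Decidable (Orbit x)
    orbit? x y = map′ Any.satisfied
      (λ (h , hx≈y) → Any.map (λ h≈k → trans (▷-cong (𝔾.sym h≈k) refl) hx≈y) (gs-complete h))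
      (any? (λ h → h ▷ x ≟ y) gs)

    orbit-resp : ∀ {x} → Orbit x Respects _≈_
    orbit-resp y≈z (h , hx≈y) = h , trans hx≈y y≈z

    ∁orbit-resp : ∀ {x} → (¬_ ∘ Orbit x) Respects _≈_
    ∁orbit-resp y≈z x↝y̸ x↝z = x↝y̸ (orbit-resp (sym y≈z) x↝z)

    orbit-sym : ∀ {x y} → Orbit x y → Orbit y x
    orbit-sym {x} {y} (h , hx≈y) = h 𝔾.⁻¹ , (begin
      h 𝔾.⁻¹ ▷ y      ≈⟨ ▷-cong 𝔾.refl hx≈y ⟨
      h 𝔾.⁻¹ ▷ h ▷ x  ≈⟨ ⁻¹-▷ h x ⟩
      x               ∎)
      where open ≈-Reasoning setoid

    orbit-trans : ∀ {x y z} → Orbit x y → Orbit y z → Orbit x z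
    orbit-trans {x} {y} {z} (h , hx≈y) (k , ky≈z) = k 𝔾.∙ h , (begin
      (k 𝔾.∙ h) ▷ x  ≈⟨ ∙-▷ k h x ⟩
      k ▷ h ▷ x      ≈⟨ ▷-cong 𝔾.refl hx≈y ⟩
      k ▷ y          ≈⟨ ky≈z ⟩
      z              ∎)
      where open ≈-Reasoning setoid

    fixed-orbit : ∀ {x y} → Fixed x → Orbit x y → Fixed y
    fixed-orbit {x} {y} x-fixed (h , hx≈y) k = begin
      k ▷ y  ≈⟨ ▷-cong 𝔾.refl y≈x ⟩
      k ▷ x  ≈⟨ x-fixed k ⟩
      x      ≈⟨ y≈x ⟨
      y      ∎
      where
      open ≈-Reasoning setoid
      y≈x : y ≈ x
      y≈x = trans (sym hx≈y) (x-fixed h)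

    fixed-resp : Fixed Respects _≈_
    fixed-resp {x} x≈y x-fixed = fixed-orbit x-fixed (𝔾.ε , trans (ε-▷ x) x≈y)

    stabiliser-size : A → ℕ
    stabiliser-size x = length (filter (λ h → h ▷ x ≟ x) gs)

    fibre-size : ∀ {x y} → Orbit x y → length (filter (λ h → h ▷ x ≟ y) gs) ≡ stabiliser-size x
    fibre-size {x} {y} (h₀ , h₀x≈y) = ≡.trans
      (≡.sym (length-filter-∘-inverse 𝔾ₛ gs! gs-complete (left-multiplication 𝔾 h₀) (λ h → h ▷ x ≟ y)
                (λ h≈k hx≈y → trans (▷-cong (𝔾.sym h≈k) refl) hx≈y)))
      (≡.cong length (filter-≐ _ _ (fixes , moves) gs))
      where
      open ≈-Reasoning setoid
      𝔾ₛ : DecSetoid g gℓ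
      𝔾ₛ = record { isDecEquivalence = record { isEquivalence = 𝔾.isEquivalence ; _≟_ = _≟ᴳ_ } }
      fixes : ∀ {h} → (h₀ 𝔾.∙ h) ▷ x ≈ y → h ▷ x ≈ x
      fixes {h} e = begin
        h ▷ x                     ≈⟨ ⁻¹-▷ h₀ (h ▷ x) ⟨
        h₀ 𝔾.⁻¹ ▷ h₀ ▷ h ▷ x      ≈⟨ ▷-cong 𝔾.refl (∙-▷ h₀ h x) ⟨
        h₀ 𝔾.⁻¹ ▷ (h₀ 𝔾.∙ h) ▷ x  ≈⟨ ▷-cong 𝔾.refl (trans e (sym h₀x≈y)) ⟩
        h₀ 𝔾.⁻¹ ▷ h₀ ▷ x          ≈⟨ ⁻¹-▷ h₀ x ⟩
        x                         ∎
      moves : ∀ {h} → h ▷ x ≈ x → (h₀ 𝔾.∙ h) ▷ x ≈ y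
      moves {h} e = begin
        (h₀ 𝔾.∙ h) ▷ x  ≈⟨ ∙-▷ h₀ h x ⟩
        h₀ ▷ h ▷ x      ≈⟨ ▷-cong 𝔾.refl e ⟩
        h₀ ▷ x          ≈⟨ h₀x≈y ⟩
        y               ∎

    orbit-stabiliser : ∀ {x O} → Unique setoid O → (∀ h → h ▷ x ∈ O) → (∀ {y} → y ∈ O → Orbit x y) →
                       length O * stabiliser-size x ≡ length gs
    orbit-stabiliser {x} {O} O! orbit⊆O O⊆orbit = begin
      length O * stabiliser-size x
        ≡⟨ sum-map-const (stabiliser-size x) O ⟨
      sum (map (λ _ → stabiliser-size x) O)
        ≡⟨ ≡.cong sum (map-cong-local (All.tabulateₛ setoid (fibre-size ∘ O⊆orbit))) ⟨
      sum (map (λ y → length (filter (λ h → h ▷ x ≟ y) gs)) O)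
        ≡⟨ sum-fibres X (_▷ x) gs O! (All.tabulate (λ {h} _ → orbit⊆O h)) ⟩
      length gs ∎
      where open ≡.≡-Reasoning

    module _ {p a} (p-prime : Prime p) (|gs|≡p^a : length gs ≡ p ^ a) where

      p∣orbit-size : ∀ {x O} → Unique setoid O → (∀ h → h ▷ x ∈ O) → (∀ {y} → y ∈ O → Orbit x y) →
                     ¬ Fixed x → p ∣ length O
      p∣orbit-size {x} {O} O! orbit⊆O O⊆orbit x-moves
        with ∣p^a⇒≡1⊎p∣ p-prime a (divides (stabiliser-size x)
               (≡.trans (≡.sym |gs|≡p^a) (≡.trans (≡.sym (orbit-stabiliser O! orbit⊆O O⊆orbit)) (*-comm (length O) _))))
      ... | inj₂ p∣|O| = p∣|O|
      ... | inj₁ |O|≡1 = contradiction |O|≡1 (singleton-orbit⇒fixed O orbit⊆O)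
        where
        singleton-orbit⇒fixed : ∀ O → (∀ h → h ▷ x ∈ O) → length O ≢ 1
        singleton-orbit⇒fixed (z ∷ []) orbit⊆[z] ≡.refl = x-moves λ h →
          trans (only (orbit⊆[z] h)) (trans (sym (only (orbit⊆[z] 𝔾.ε))) (ε-▷ x))
          where
          only : ∀ {y} → y ∈ z ∷ [] → y ≈ z
          only (here y≈z) = y≈z
        singleton-orbit⇒fixed [] _ ()
        singleton-orbit⇒fixed (_ ∷ _ ∷ _) _ ()

      Closed : List A → Set _
      Closed L = ∀ h {y} → y ∈ L → h ▷ y ∈ L

      module _ {L} (L! : Unique setoid L) (L-closed : Closed L) {x} (x∈L : x ∈ L) where

        p∣#non-fixed-in-orbit : p ∣ length (filter (¬? ∘ fixed?) (filter (orbit? x) L))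
        p∣#non-fixed-in-orbit with fixed? x
        ... | yes x-fixed = subst (λ l → p ∣ length l) (≡.sym (filter-none (¬? ∘ fixed?) (All.map
              (λ x↝y y-moves → y-moves (fixed-orbit x-fixed x↝y)) (all-filter (orbit? x) L)))) (p ∣0)
        ... | no x-moves = subst (λ l → p ∣ length l) (≡.sym (filter-all (¬? ∘ fixed?) (All.map
              (λ x↝y y-fixed → x-moves (fixed-orbit y-fixed (orbit-sym x↝y))) (all-filter (orbit? x) L))))
              (p∣orbit-size (filter⁺ setoid (orbit? x) L!)
                 (λ h → ∈-filter⁺ setoid (orbit? x) orbit-resp (L-closed h x∈L) (h , refl))
                 (proj₂ ∘ ∈-filter⁻ setoid (orbit? x) orbit-resp {xs = L}) x-moves)

        outside-orbit-closed : Closed (filter (¬? ∘ orbit? x) L)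
        outside-orbit-closed h y∈R with ∈-filter⁻ setoid (¬? ∘ orbit? x) ∁orbit-resp y∈R
        ... | y∈L , x↝̸y = ∈-filter⁺ setoid (¬? ∘ orbit? x) ∁orbit-resp (L-closed h y∈L)
                             (λ x↝hy → x↝̸y (orbit-trans x↝hy (orbit-sym (h , refl))))

      p∣#non-fixed : ∀ {L} → Unique setoid L → Closed L → p ∣ length (filter (¬? ∘ fixed?) L)
      p∣#non-fixed {L} L! L-closed = go L L! L-closed (<-wellFounded (length L))
        where
        go : ∀ L → Unique setoid L → Closed L → Acc _<_ (length L) → p ∣ length (filter (¬? ∘ fixed?) L)
        go [] _ _ _ = p ∣0
        go L@(x ∷ _) L! L-closed (acc smaller) =
          subst (p ∣_) (≡.sym (length-filter-partition (orbit? x) (¬? ∘ fixed?) L))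
            (∣m∣n⇒∣m+n (p∣#non-fixed-in-orbit L! L-closed x∈L)
               (go _ (filter⁺ setoid (¬? ∘ orbit? x) L!) (outside-orbit-closed L! L-closed x∈L)
                   (smaller (filter-notAll (¬? ∘ orbit? x) L (here λ x↝̸x → x↝̸x (𝔾.ε , ε-▷ x))))))
          where
          x∈L : x ∈ L
          x∈L = here refl

module FunctionEnumeration where

  open import Data.Nat using (zero)
  open import Data.Fin using (Fin)
  import Data.Fin as Fin
  open import Data.List using ([_]; cartesianProductWith)
  open import Data.List.Relation.Unary.Any using (here)
  open import Data.List.Relation.Unary.Enumerates.Setoid using (IsEnumeration)
  open import Data.List.Membership.Setoid.Properties using (∈-cartesianProductWith⁺; ∈-resp-≈)
  open import Data.Vec.Functional using (head; tail) renaming (_∷_ to _◂_)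
  open import Relation.Binary.PropositionalEquality as ≡ using (_→-setoid_)

  functions : ∀ {a} {A : Set a} (k : ℕ) → List A → List (Fin k → A)
  functions zero as = [ (λ ()) ]
  functions (suc k) as = cartesianProductWith _◂_ as (functions k as)

  functions-complete : ∀ {a} {A : Set a} {as : List A} → IsEnumeration (≡.setoid A) as →
                       ∀ k → IsEnumeration (Fin k →-setoid A) (functions k as)
  functions-complete as-complete zero f = here (λ ())
  functions-complete {A = A} as-complete (suc k) f =
    ∈-resp-≈ (Fin (suc k) →-setoid A) head◂tail
      (∈-cartesianProductWith⁺ (≡.setoid A) (Fin k →-setoid A) (Fin (suc k) →-setoid A) ◂-cong
        (as-complete (head f)) (functions-complete as-complete k (tail f)))
    where
    head◂tail : ∀ i → (head f ◂ tail f) i ≡ f i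
    head◂tail Fin.zero = ≡.refl
    head◂tail (Fin.suc i) = ≡.refl
    ◂-cong : ∀ {a b} {g h : Fin k → A} → a ≡ b → (∀ i → g i ≡ h i) → ∀ i → (a ◂ g) i ≡ (b ◂ h) i
    ◂-cong a≡b g≗h Fin.zero = a≡b
    ◂-cong a≡b g≗h (Fin.suc i) = g≗h i

module ModularSpans where

  open import Level using (_⊔_)
  open import Algebra.Bundles using (AbelianGroup)
  open import Algebra.Morphism.Structures using (module MonoidMorphisms)
  open import Data.Nat using (zero; _%_; _/_) renaming (_+_ to _+ℕ_; _*_ to _*ℕ_)
  open import Data.Nat.DivMod using (m≡m%n+[m/n]*n; _mod_; m%n<n)
  open import Data.Fin using (toℕ)
  open import Data.Fin.Properties using (any?; toℕ-fromℕ<)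
  open import Data.List using ([]; _∷_)
  open import Data.Product using (∃-syntax)
  open import Relation.Binary.Bundles using (Setoid)
  open import Relation.Binary.Definitions using (_Respects_)
  import Relation.Binary.Definitions as B
  import Relation.Binary.PropositionalEquality as ≡
  open import Relation.Nullary.Decidable using (map′)
  open import Relation.Unary using (Pred; Decidable)
  open MonoidMorphisms using (IsMonoidHomomorphism)

  HasExponentDividing : ∀ {c ℓ} → AbelianGroup c ℓ → ℕ → Set (c ⊔ ℓ)
  HasExponentDividing A m = ∀ x → m × x ≈ ε
    where
    open AbelianGroup A
    open import Algebra.Definitions.RawMonoid rawMonoid using (_×_)

  module Spans {c ℓ} (A : AbelianGroup c ℓ) {k : ℕ} (exponent : HasExponentDividing A (suc k)) where

    open AbelianGroup A
      renaming (_∙_ to infixl 6 _+_; ε to 0#; _⁻¹ to infix 8 -_; ∙-cong to +-cong; ∙-congˡ to +-congˡ;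
                ∙-congʳ to +-congʳ; identityˡ to +-identityˡ; identityʳ to +-identityʳ; assoc to +-assoc)
    open import Algebra.Properties.AbelianGroup A using (⁻¹-∙-comm; ε⁻¹≈ε; ⁻¹-anti-homo‿-)
    open import Algebra.Properties.CommutativeMonoid.Mult commutativeMonoid
      using (_×_; ×-homo-+; ×-assocˡ; ×-distrib-+; ×-congʳ; ×-congˡ; ×-homo-1)
    open import Algebra.Properties.CommutativeSemigroup commutativeSemigroup using (interchange)
    open import Relation.Binary.Reasoning.Setoid setoid

    -‿+-distrib : ∀ x y → - (x + y) ≈ - x + - y
    -‿+-distrib x y = sym (⁻¹-∙-comm x y)

    [x-y]+[y-z]≈x-z : ∀ x y z → (x - y) + (y - z) ≈ x - z
    [x-y]+[y-z]≈x-z x y z = begin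
      x - y + (y - z)      ≈⟨ +-assoc x (- y) (y - z) ⟩
      x + (- y + (y - z))  ≈⟨ +-congˡ (+-assoc (- y) y (- z)) ⟨
      x + (- y + y - z)    ≈⟨ +-congˡ (+-congʳ (inverseˡ y)) ⟩
      x + (0# - z)         ≈⟨ +-congˡ (+-identityˡ (- z)) ⟩
      x - z                ∎

    [x+y]-[z+w]≈[x-z]+[y-w] : ∀ x y z w → (x + y) - (z + w) ≈ (x - z) + (y - w)
    [x+y]-[z+w]≈[x-z]+[y-w] x y z w = trans (+-congˡ (-‿+-distrib z w)) (interchange x y (- z) (- w))

    x-0≈x : ∀ x → x - 0# ≈ x
    x-0≈x x = trans (+-congˡ ε⁻¹≈ε) (+-identityʳ x)

    ×-zeroʳ : ∀ n → n × 0# ≈ 0#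
    ×-zeroʳ zero = refl
    ×-zeroʳ (suc n) = trans (+-congˡ (×-zeroʳ n)) (+-identityˡ 0#)

    ×-‿-comm : ∀ n x → n × (- x) ≈ - (n × x)
    ×-‿-comm zero x = sym ε⁻¹≈ε
    ×-‿-comm (suc n) x = trans (+-congˡ (×-‿-comm n x)) (sym (-‿+-distrib x (n × x)))

    -x≈k×x : ∀ x → - x ≈ k × x
    -x≈k×x x = begin
      - x                ≈⟨ +-identityʳ (- x) ⟨
      - x + 0#           ≈⟨ +-congˡ (exponent x) ⟨
      - x + (x + k × x)  ≈⟨ +-assoc (- x) x (k × x) ⟨
      - x + x + k × x    ≈⟨ +-congʳ (inverseˡ x) ⟩
      0# + k × x         ≈⟨ +-identityˡ (k × x) ⟩
      k × x              ∎

    ×-% : ∀ n x → n × x ≈ (n % suc k) × x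
    ×-% n x = begin
      n × x                                         ≡⟨ ≡.cong (_× x) (m≡m%n+[m/n]*n n (suc k)) ⟩
      (n % suc k +ℕ (n / suc k) *ℕ suc k) × x       ≈⟨ ×-homo-+ x (n % suc k) _ ⟩
      (n % suc k) × x + ((n / suc k) *ℕ suc k) × x  ≈⟨ +-congˡ (×-assocˡ x (n / suc k) (suc k)) ⟨
      (n % suc k) × x + (n / suc k) × (suc k × x)   ≈⟨ +-congˡ (×-congʳ (n / suc k) (exponent x)) ⟩
      (n % suc k) × x + (n / suc k) × 0#            ≈⟨ +-congˡ (×-zeroʳ (n / suc k)) ⟩
      (n % suc k) × x + 0#                          ≈⟨ +-identityʳ _ ⟩
      (n % suc k) × x                               ∎

    -- A datatype rather than InSpan vs (x - y) itself, so that x, vs and y can be inferred.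
    infix 4 _∼[_]_
    data _∼[_]_ (x : Carrier) (vs : List Carrier) (y : Carrier) : Set ℓ

    InSpan : List Carrier → Pred Carrier ℓ
    InSpan [] x = x ≈ 0#
    InSpan (v ∷ vs) x = ∃[ n ] x ∼[ vs ] n × v

    data _∼[_]_ x vs y where
      mk∼ : InSpan vs (x - y) → x ∼[ vs ] y

    difference∈span : ∀ {x vs y} → x ∼[ vs ] y → InSpan vs (x - y)
    difference∈span (mk∼ x-y∈vs) = x-y∈vs

    span-resp : ∀ vs → InSpan vs Respects _≈_
    span-resp [] x≈y x≈0 = trans (sym x≈y) x≈0
    span-resp (v ∷ vs) x≈y (n , mk∼ p) = n , mk∼ (span-resp vs (+-congʳ x≈y) p)

    span-0 : ∀ vs → InSpan vs 0#
    span-0 [] = refl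
    span-0 (v ∷ vs) = 0 , mk∼ (span-resp vs (sym (x-0≈x 0#)) (span-0 vs))

    span-+ : ∀ vs {x y} → InSpan vs x → InSpan vs y → InSpan vs (x + y)
    span-+ [] x≈0 y≈0 = trans (+-cong x≈0 y≈0) (+-identityˡ 0#)
    span-+ (v ∷ vs) {x} {y} (m , mk∼ p) (n , mk∼ q) = m +ℕ n , mk∼ (span-resp vs eq (span-+ vs p q))
      where
      eq : (x - m × v) + (y - n × v) ≈ (x + y) - (m +ℕ n) × v
      eq = trans (sym ([x+y]-[z+w]≈[x-z]+[y-w] x y (m × v) (n × v))) (+-congˡ (⁻¹-cong (sym (×-homo-+ v m n))))

    span-× : ∀ vs n {x} → InSpan vs x → InSpan vs (n × x)
    span-× [] n x≈0 = trans (×-congʳ n x≈0) (×-zeroʳ n)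
    span-× (v ∷ vs) n {x} (m , mk∼ p) = n *ℕ m , mk∼ (span-resp vs eq (span-× vs n p))
      where
      eq : n × (x - m × v) ≈ n × x - (n *ℕ m) × v
      eq = trans (×-distrib-+ x (- (m × v)) n) (+-congˡ (trans (×-‿-comm n (m × v)) (⁻¹-cong (×-assocˡ v n m))))

    span-‿ : ∀ vs {x} → InSpan vs x → InSpan vs (- x)
    span-‿ vs p = span-resp vs (sym (-x≈k×x _)) (span-× vs k p)

    module Congruence (vs : List Carrier) where

      ≈⇒∼ : ∀ {x y} → x ≈ y → x ∼[ vs ] y
      ≈⇒∼ {x} {y} x≈y = mk∼ (span-resp vs (sym (trans (+-congʳ x≈y) (inverseʳ y))) (span-0 vs))

      ∼-sym : ∀ {x y} → x ∼[ vs ] y → y ∼[ vs ] x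
      ∼-sym {x} {y} (mk∼ p) = mk∼ (span-resp vs (⁻¹-anti-homo‿- x y) (span-‿ vs p))

      ∼-trans : ∀ {x y z} → x ∼[ vs ] y → y ∼[ vs ] z → x ∼[ vs ] z
      ∼-trans {x} {y} {z} (mk∼ p) (mk∼ q) = mk∼ (span-resp vs ([x-y]+[y-z]≈x-z x y z) (span-+ vs p q))

      ∼-setoid : Setoid c ℓ
      ∼-setoid = record { _≈_ = _∼[ vs ]_ ; isEquivalence = record { refl = ≈⇒∼ refl ; sym = ∼-sym ; trans = ∼-trans } }

      ∼-+ : ∀ {x x′ y y′} → x ∼[ vs ] x′ → y ∼[ vs ] y′ → x + y ∼[ vs ] x′ + y′
      ∼-+ {x} {x′} {y} {y′} (mk∼ p) (mk∼ q) =
        mk∼ (span-resp vs (sym ([x+y]-[z+w]≈[x-z]+[y-w] x y x′ y′)) (span-+ vs p q))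

      ∼-+ˡ : ∀ x {y y′} → y ∼[ vs ] y′ → x + y ∼[ vs ] x + y′
      ∼-+ˡ x = ∼-+ (≈⇒∼ {x} refl)

      ∼-+ʳ : ∀ y {x x′} → x ∼[ vs ] x′ → x + y ∼[ vs ] x′ + y
      ∼-+ʳ y x∼x′ = ∼-+ x∼x′ (≈⇒∼ {y} refl)

      ∼-× : ∀ n {x y} → x ∼[ vs ] y → n × x ∼[ vs ] n × y
      ∼-× n {x} {y} (mk∼ p) = mk∼ (span-resp vs (trans (×-distrib-+ x (- y) n) (+-congˡ (×-‿-comm n y))) (span-× vs n p))

      span⇒∼0 : ∀ {x} → InSpan vs x → x ∼[ vs ] 0#
      span⇒∼0 {x} p = mk∼ (span-resp vs (sym (x-0≈x x)) p)

      ∼0⇒span : ∀ {x} → x ∼[ vs ] 0# → InSpan vs x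
      ∼0⇒span {x} (mk∼ p) = span-resp vs (x-0≈x x) p

      span-∼ : ∀ {x y} → x ∼[ vs ] y → InSpan vs y → InSpan vs x
      span-∼ x∼y y∈vs = ∼0⇒span (∼-trans x∼y (span⇒∼0 y∈vs))

    span-∷ : ∀ v vs {x} → InSpan vs x → InSpan (v ∷ vs) x
    span-∷ v vs x∈vs = 0 , Congruence.span⇒∼0 vs x∈vs

    span-head : ∀ v vs → InSpan (v ∷ vs) v
    span-head v vs = 1 , Congruence.≈⇒∼ vs (sym (×-homo-1 v))

    ∼⇒∼∷ : ∀ {v vs x y} → x ∼[ vs ] y → x ∼[ v ∷ vs ] y
    ∼⇒∼∷ {v} {vs} (mk∼ x-y∈vs) = mk∼ (span-∷ v vs x-y∈vs)

    module _ (_≟_ : B.Decidable _≈_) where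

      span? : ∀ vs → Decidable (InSpan vs)
      span? [] x = x ≟ 0#
      span? (v ∷ vs) x = map′ (λ (c , p) → toℕ c , mk∼ p) reduce (any? (λ c → span? vs (x - toℕ c × v)))
        where
        reduce : InSpan (v ∷ vs) x → ∃[ c ] InSpan vs (x - toℕ c × v)
        reduce (n , mk∼ p) = n mod suc k ,
          span-resp vs (+-congˡ (⁻¹-cong (trans (×-% n v) (×-congˡ (≡.sym (toℕ-fromℕ< (m%n<n n (suc k)))))))) p

    module InvariantFlags {i} {I : Set i} (φ : I → Carrier → Carrier)
                          (φ-hom : ∀ j → IsMonoidHomomorphism rawMonoid rawMonoid (φ j)) where

      private
        module φ j = IsMonoidHomomorphism (φ-hom j)

      φ-× : ∀ j n x → φ j (n × x) ≈ n × φ j x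
      φ-× j zero x = φ.ε-homo j
      φ-× j (suc n) x = trans (φ.homo j x (n × x)) (+-congˡ (φ-× j n x))

      φ-‿ : ∀ j x y → φ j (x - y) ≈ φ j x - φ j y
      φ-‿ j x y = begin
        φ j (x - y)          ≈⟨ φ.homo j x (- y) ⟩
        φ j x + φ j (- y)    ≈⟨ +-congˡ (φ.⟦⟧-cong j (-x≈k×x y)) ⟩
        φ j x + φ j (k × y)  ≈⟨ +-congˡ (φ-× j k y) ⟩
        φ j x + k × φ j y    ≈⟨ +-congˡ (-x≈k×x (φ j y)) ⟨
        φ j x - φ j y        ∎

      data Flag : List Carrier → Set (c ⊔ i ⊔ ℓ) where
        [] : Flag []
        _∷_ : ∀ {v vs} → (∀ j → φ j v ∼[ vs ] v) → Flag vs → Flag (v ∷ vs)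

      span-invariant : ∀ {vs} → Flag vs → ∀ j {x} → InSpan vs x → InSpan vs (φ j x)
      span-invariant [] j x≈0 = trans (φ.⟦⟧-cong j x≈0) (φ.ε-homo j)
      span-invariant {v ∷ vs} (φv∼v ∷ flag) j {x} (n , mk∼ p) =
        n , mk∼ (span-resp vs eq (span-+ vs (span-invariant flag j p) (span-× vs n (difference∈span (φv∼v j)))))
        where
        eq : φ j (x - n × v) + n × (φ j v - v) ≈ φ j x - n × v
        eq = begin
          φ j (x - n × v) + n × (φ j v - v)              ≈⟨ +-cong (φ-‿ j x (n × v)) (×-distrib-+ (φ j v) (- v) n) ⟩
          (φ j x - φ j (n × v)) + (n × φ j v + n × - v)  ≈⟨ +-cong (+-congˡ (⁻¹-cong (φ-× j n v)))
                                                                      (+-congˡ (×-‿-comm n v)) ⟩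
          (φ j x - n × φ j v) + (n × φ j v - n × v)      ≈⟨ [x-y]+[y-z]≈x-z (φ j x) (n × φ j v) (n × v) ⟩
          φ j x - n × v                                  ∎

      ∼-invariant : ∀ {vs} → Flag vs → ∀ j {x y} → x ∼[ vs ] y → φ j x ∼[ vs ] φ j y
      ∼-invariant {vs} flag j {x} {y} (mk∼ p) = mk∼ (span-resp vs (φ-‿ j x y) (span-invariant flag j p))

module IntegersModulo (k : ℕ) where

  open import Algebra.Bundles using (AbelianGroup)
  open import Data.Nat using (zero; _+_; _*_; _∸_; _%_)
  open import Data.Nat.Properties using (+-comm; +-assoc; +-identityʳ; *-comm; m+[n∸m]≡n; <⇒≤)
  open import Data.Nat.DivMod using (_mod_; %-distribˡ-+; m<n⇒m%n≡m; n%n≡0; m%n<n; m*n%n≡0)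
  open import Data.Fin using (toℕ) renaming (zero to 0F)
  open import Data.Fin.Properties using (toℕ-injective; toℕ-fromℕ<; toℕ<n)
  open import Relation.Binary.PropositionalEquality using (refl; sym; trans; cong; cong₂; isEquivalence; module ≡-Reasoning)
  open ModularSpans using (HasExponentDividing)

  private
    m = suc k

  [_] : ℕ → Zmod m
  [ n ] = n mod m

  toℕ-[] : ∀ n → toℕ [ n ] ≡ n % m
  toℕ-[] n = toℕ-fromℕ< (m%n<n n m)

  [toℕ] : ∀ a → [ toℕ a ] ≡ a
  [toℕ] a = toℕ-injective (trans (toℕ-[] (toℕ a)) (m<n⇒m%n≡m (toℕ<n a)))

  []-homo-+ : ∀ x y → [ x + y ] ≡ [ x ] +ₘ [ y ]
  []-homo-+ x y = toℕ-injective (begin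
    toℕ [ x + y ]                 ≡⟨ toℕ-[] (x + y) ⟩
    (x + y) % m                   ≡⟨ %-distribˡ-+ x y m ⟩
    (x % m + y % m) % m           ≡⟨ cong₂ (λ a b → (a + b) % m) (toℕ-[] x) (toℕ-[] y) ⟨
    (toℕ [ x ] + toℕ [ y ]) % m   ≡⟨ toℕ-[] (toℕ [ x ] + toℕ [ y ]) ⟨
    toℕ ([ x ] +ₘ [ y ])          ∎)
    where open ≡-Reasoning

  infix 30 -ₘ_
  -ₘ_ : Zmod m → Zmod m
  -ₘ a = [ m ∸ toℕ a ]

  +ₘ-0-abelianGroup : AbelianGroup _ _
  +ₘ-0-abelianGroup = record
    { Carrier = Zmod m ; _≈_ = _≡_ ; _∙_ = _+ₘ_ ; ε = 0F ; _⁻¹ = -ₘ_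
    ; isAbelianGroup = record
      { isGroup = record
        { isMonoid = record
          { isSemigroup = record { isMagma = record { isEquivalence = isEquivalence ; ∙-cong = cong₂ _+ₘ_ } ; assoc = assoc }
          ; identity = identityˡ , identityʳ }
        ; inverse = inverseˡ , inverseʳ
        ; ⁻¹-cong = cong -ₘ_ }
      ; comm = comm } }
    where
    open ≡-Reasoning
    []-absorbˡ : ∀ x y → [ toℕ [ x ] + y ] ≡ [ x + y ]
    []-absorbˡ x y = trans ([]-homo-+ (toℕ [ x ]) y) (trans (cong (_+ₘ [ y ]) ([toℕ] [ x ])) (sym ([]-homo-+ x y)))
    []-absorbʳ : ∀ x y → [ x + toℕ [ y ] ] ≡ [ x + y ]
    []-absorbʳ x y = trans ([]-homo-+ x (toℕ [ y ])) (trans (cong ([ x ] +ₘ_) ([toℕ] [ y ])) (sym ([]-homo-+ x y)))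
    comm : ∀ a b → a +ₘ b ≡ b +ₘ a
    comm a b = cong [_] (+-comm (toℕ a) (toℕ b))
    assoc : ∀ a b c → (a +ₘ b) +ₘ c ≡ a +ₘ (b +ₘ c)
    assoc a b c = begin
      [ toℕ [ toℕ a + toℕ b ] + toℕ c ]  ≡⟨ []-absorbˡ (toℕ a + toℕ b) (toℕ c) ⟩
      [ toℕ a + toℕ b + toℕ c ]          ≡⟨ cong [_] (+-assoc (toℕ a) (toℕ b) (toℕ c)) ⟩
      [ toℕ a + (toℕ b + toℕ c) ]        ≡⟨ []-absorbʳ (toℕ a) (toℕ b + toℕ c) ⟨
      [ toℕ a + toℕ [ toℕ b + toℕ c ] ]  ∎
    identityʳ : ∀ a → a +ₘ 0F ≡ a
    identityʳ a = trans (cong [_] (+-identityʳ (toℕ a))) ([toℕ] a)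
    identityˡ : ∀ a → 0F +ₘ a ≡ a
    identityˡ a = trans (comm 0F a) (identityʳ a)
    inverseʳ : ∀ a → a +ₘ -ₘ a ≡ 0F
    inverseʳ a = begin
      a +ₘ -ₘ a                   ≡⟨ cong (_+ₘ -ₘ a) ([toℕ] a) ⟨
      [ toℕ a ] +ₘ [ m ∸ toℕ a ]  ≡⟨ []-homo-+ (toℕ a) (m ∸ toℕ a) ⟨
      [ toℕ a + (m ∸ toℕ a) ]     ≡⟨ cong [_] (m+[n∸m]≡n (<⇒≤ (toℕ<n a))) ⟩
      [ m ]                       ≡⟨ toℕ-injective (trans (toℕ-[] m) (n%n≡0 m)) ⟩
      0F                          ∎
    inverseˡ : ∀ a → -ₘ a +ₘ a ≡ 0F
    inverseˡ a = trans (comm (-ₘ a) a) (inverseʳ a)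

  open import Algebra.Properties.CommutativeMonoid.Mult (AbelianGroup.commutativeMonoid +ₘ-0-abelianGroup) using (_×_)

  ×-[] : ∀ n a → n × a ≡ [ n * toℕ a ]
  ×-[] zero a = refl
  ×-[] (suc n) a = begin
    a +ₘ (n × a)                 ≡⟨ cong₂ _+ₘ_ ([toℕ] a) (sym (×-[] n a)) ⟨
    [ toℕ a ] +ₘ [ n * toℕ a ]   ≡⟨ []-homo-+ (toℕ a) (n * toℕ a) ⟨
    [ toℕ a + n * toℕ a ]        ∎
    where open ≡-Reasoning

  +ₘ-exponent : HasExponentDividing +ₘ-0-abelianGroup m
  +ₘ-exponent a = trans (×-[] m a) (toℕ-injective (begin
    toℕ [ m * toℕ a ]   ≡⟨ toℕ-[] (m * toℕ a) ⟩
    (m * toℕ a) % m     ≡⟨ cong (_% m) (*-comm m (toℕ a)) ⟩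
    (toℕ a * m) % m     ≡⟨ m*n%n≡0 (toℕ a) m ⟩
    0                   ∎))
    where open ≡-Reasoning

module SubgroupsOfPermutations where

  open import Level using (0ℓ)
  open import Algebra.Bundles using (Group)
  open import Data.Fin.Permutation using (_⟨$⟩ʳ_; _⟨$⟩ˡ_; inverseˡ; inverseʳ; id; flip; _∘ₚ_)
  open import Data.List using ([]; _∷_)
  open import Data.List.Relation.Unary.All using ([]; _∷_; toList)
  open import Data.List.Relation.Unary.Any using (here; there)
  open import Data.List.Relation.Unary.AllPairs using ([]; _∷_)
  open import Data.List.Relation.Unary.Unique.Setoid using (Unique)
  open import Data.List.Relation.Unary.Enumerates.Setoid using (IsEnumeration)
  open import Data.Product using (Σ; proj₁)
  open import Relation.Binary.PropositionalEquality as ≡ using (cong)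

  ⟨$⟩ˡ-cong : ∀ {n} {g h : Permutation′ n} → g ≈ₚ h → ∀ i → g ⟨$⟩ˡ i ≡ h ⟨$⟩ˡ i
  ⟨$⟩ˡ-cong {g = g} {h} g≈h i = begin
    g ⟨$⟩ˡ i                       ≡⟨ inverseˡ h ⟨
    h ⟨$⟩ˡ (h ⟨$⟩ʳ (g ⟨$⟩ˡ i))     ≡⟨ cong (h ⟨$⟩ˡ_) (g≈h (g ⟨$⟩ˡ i)) ⟨
    h ⟨$⟩ˡ (g ⟨$⟩ʳ (g ⟨$⟩ˡ i))     ≡⟨ cong (h ⟨$⟩ˡ_) (inverseʳ g) ⟩
    h ⟨$⟩ˡ i                       ∎
    where open ≡.≡-Reasoning

  module _ {n} {G : Permutation′ n → Set} (G-subgroup : IsSubgroup G) where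

    open IsSubgroup G-subgroup

    subgroup : Group 0ℓ 0ℓ
    subgroup = record
      { Carrier = Σ (Permutation′ n) G
      ; _≈_ = λ g h → proj₁ g ≈ₚ proj₁ h
      ; _∙_ = λ (g , g∈G) (h , h∈G) → h ∘ₚ g , closed-∘ h∈G g∈G
      ; ε = id , has-id
      ; _⁻¹ = λ (g , g∈G) → flip g , closed-⁻¹ g∈G
      ; isGroup = record
        { isMonoid = record
          { isSemigroup = record
            { isMagma = record
              { isEquivalence = record
                { refl = λ i → ≡.refl
                ; sym = λ g≈h i → ≡.sym (g≈h i)
                ; trans = λ g≈h h≈k i → ≡.trans (g≈h i) (h≈k i) }
              ; ∙-cong = λ {(g , _)} g≈g′ h≈h′ i → ≡.trans (cong (g ⟨$⟩ʳ_) (h≈h′ i)) (g≈g′ _) }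
            ; assoc = λ _ _ _ i → ≡.refl }
          ; identity = (λ _ i → ≡.refl) , (λ _ i → ≡.refl) }
        ; inverse = (λ (g , _) i → inverseˡ g) , (λ (g , _) i → inverseʳ g)
        ; ⁻¹-cong = λ {(g , _)} {(h , _)} → ⟨$⟩ˡ-cong {g = g} {h} } }

    open Group subgroup using (setoid)

    length-toList : ∀ {gs} (G∋gs : All G gs) → length (toList G∋gs) ≡ length gs
    length-toList [] = ≡.refl
    length-toList (_ ∷ G∋gs) = cong suc (length-toList G∋gs)

    toList-unique : ∀ {gs} (G∋gs : All G gs) → AllPairs (λ g h → ¬ g ≈ₚ h) gs → Unique setoid (toList G∋gs)
    toList-unique [] [] = []
    toList-unique {g ∷ _} (_ ∷ G∋gs) (g≉gs ∷ gs!) = distinct g G∋gs g≉gs ∷ toList-unique G∋gs gs!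
      where
      distinct : ∀ g {hs} (G∋hs : All G hs) → All (λ h → ¬ g ≈ₚ h) hs →
                 All (λ h → ¬ g ≈ₚ proj₁ h) (toList G∋hs)
      distinct g [] [] = []
      distinct g (_ ∷ G∋hs) (g≉h ∷ g≉hs) = g≉h ∷ distinct g G∋hs g≉hs

    toList-complete : ∀ {gs} (G∋gs : All G gs) → (∀ g → G g → Any (g ≈ₚ_) gs) → IsEnumeration setoid (toList G∋gs)
    toList-complete G∋gs gs-complete (g , g∈G) = lift G∋gs (gs-complete g g∈G)
      where
      lift : ∀ {hs} (G∋hs : All G hs) → Any (g ≈ₚ_) hs → Any (λ h → g ≈ₚ proj₁ h) (toList G∋hs)
      lift (_ ∷ _) (here g≈h) = here g≈h
      lift (_ ∷ G∋hs) (there g∈hs) = there (lift G∋hs g∈hs)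

module Configurations (k n : ℕ) where

  open import Level using (0ℓ)
  open import Algebra.Bundles using (AbelianGroup)
  import Algebra.Construct.Pointwise as Pointwise
  import Algebra.Properties.CommutativeMonoid.Mult as Mult
  open import Algebra.Morphism.Structures using (module MonoidMorphisms)
  open import Data.Nat using (zero)
  open import Data.Fin using (Fin)
  open import Data.Fin.Permutation using (_⟨$⟩ˡ_; inverseˡ; flip)
  import Data.Fin.Properties as Fin
  import Relation.Binary.Definitions as B
  open import Relation.Binary.PropositionalEquality as ≡ using (cong)
  open MonoidMorphisms using (IsMonoidHomomorphism)
  open ModularSpans using (HasExponentDividing)
  open IntegersModulo k using (+ₘ-0-abelianGroup; +ₘ-exponent)
  open SubgroupsOfPermutations using (⟨$⟩ˡ-cong)

  V : AbelianGroup 0ℓ 0ℓ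
  V = Pointwise.abelianGroup (Fin n) +ₘ-0-abelianGroup

  open AbelianGroup V public using (Carrier; _≈_; setoid; rawMonoid) renaming (ε to 0#)
  open Mult (AbelianGroup.commutativeMonoid V) using (_×_)
  private
    module 𝔽 = Mult (AbelianGroup.commutativeMonoid +ₘ-0-abelianGroup)

  ×-pointwise : ∀ m x i → (m × x) i ≡ m 𝔽.× x i
  ×-pointwise zero x i = ≡.refl
  ×-pointwise (suc m) x i = cong (x i +ₘ_) (×-pointwise m x i)

  exponentⱽ : HasExponentDividing V (suc k)
  exponentⱽ x i = ≡.trans (×-pointwise (suc k) x i) (+ₘ-exponent (x i))

  _≟_ : B.Decidable _≈_
  x ≟ y = Fin.all? (λ i → x i Fin.≟ y i)

  permute-hom : ∀ g → IsMonoidHomomorphism rawMonoid rawMonoid (permute g)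
  permute-hom g = record
    { isMagmaHomomorphism = record
      { isRelHomomorphism = record { cong = λ x≈y i → x≈y (g ⟨$⟩ˡ i) }
      ; homo = λ x y i → ≡.refl }
    ; ε-homo = λ i → ≡.refl }

  permute-flip : ∀ g x → permute (flip g) (permute g x) ≈ x
  permute-flip g x i = cong x (inverseˡ g)

  permute-cong : ∀ {g h} → g ≈ₚ h → ∀ x → permute g x ≈ permute h x
  permute-cong {g} {h} g≈h x i = cong x (⟨$⟩ˡ-cong {g = g} {h} g≈h i)

module Lifting (k n : ℕ) {G : Permutation′ n → Set} (G-subgroup : IsSubgroup G) where

  open import Algebra.Bundles using (AbelianGroup)
  open import Data.Nat using (zero; _≤_) renaming (_+_ to _+ℕ_)
  open import Data.Nat.Properties
    using (≤∧≢⇒<; +-suc; +-identityʳ; m≤n+m; <⇒≤; ≤-antisym; ≤-trans; ≤-reflexive) renaming (_≟_ to _≟ℕ_)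
  open import Data.Nat.DivMod using (_%_; m%n<n)
  open import Data.Fin using (toℕ)
  open import Data.Fin.Permutation using (id; _∘ₚ_; flip)
  open import Data.List using ([]; _∷_; _++_; replicate)
  open import Data.Product using (Σ; proj₁)
  open import Data.Sum using (_⊎_; inj₁; inj₂)
  open import Function using (_∘_)
  import Relation.Binary.PropositionalEquality as ≡
  import Relation.Binary.Reasoning.Setoid as ≈-Reasoning
  open import Relation.Nullary using (yes; no; contradiction)
  open IsSubgroup G-subgroup
  open Configurations k n
  open AbelianGroup V using (refl; sym; trans; assoc; comm; ∙-congˡ; ∙-congʳ; identityʳ) renaming (_∙_ to infixl 6 _+_)
  open import Algebra.Properties.CommutativeMonoid.Mult (AbelianGroup.commutativeMonoid V) using (_×_)
  open ModularSpans.Spans V {k} exponentⱽ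

  p : ℕ
  p = suc k

  permuteᴳ : Σ (Permutation′ n) G → Carrier → Carrier
  permuteᴳ g = permute (proj₁ g)

  open InvariantFlags permuteᴳ (permute-hom ∘ proj₁) public

  Perms : Set
  Perms = ℕ → Permutation′ n

  InG : Perms → Set
  InG σ = ∀ i → G (σ i)

  shift : ℕ → Perms → Perms
  shift m σ i = σ (m +ℕ i)

  Reaches : (Carrier → Set) → Carrier → List Carrier → Perms → Set
  Reaches Q c [] σ = Q c
  Reaches Q c (y ∷ ys) σ = Q c ⊎ Reaches Q (permute (σ 0) (c + y)) ys (λ i → σ (suc i))

  Wins : (Carrier → Set) → List Carrier → Set
  Wins Q ys = ∀ c σ → InG σ → Reaches Q c ys σ

  reaches-now : ∀ {Q c} ys σ → Q c → Reaches Q c ys σ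
  reaches-now [] σ q = q
  reaches-now (y ∷ ys) σ q = inj₁ q

  reaches⇒zero : ∀ {c} S σ → Reaches (InSpan []) c S σ → ZeroAtSomePoint c S σ
  reaches⇒zero [] σ c≈0 i = ≡.cong toℕ (c≈0 i)
  reaches⇒zero (s ∷ S) σ (inj₁ c≈0) = inj₁ (λ i → ≡.cong toℕ (c≈0 i))
  reaches⇒zero (s ∷ S) σ (inj₂ r) = inj₂ (reaches⇒zero S (λ i → σ (suc i)) r)

  lift : Carrier → List Carrier → List Carrier
  after : Carrier → List Carrier → List Carrier
  lift v S = replicate p v ++ after v S
  after v [] = []
  after v (s ∷ S) = s ∷ lift v S

  module Lift {v ws} (ws-flag : Flag ws) (v-fixed : ∀ g → permuteᴳ g v ∼[ ws ] v) where

    open Congruence ws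

    W W′ : Carrier → Set
    W = InSpan ws
    W′ = InSpan (v ∷ ws)

    play-v : ℕ → Carrier → Perms → Carrier
    play-v zero z σ = z
    play-v (suc m) z σ = play-v m (permute (σ 0) (z + v)) (λ i → σ (suc i))

    composite : ℕ → Perms → Permutation′ n
    composite zero σ = id
    composite (suc m) σ = σ 0 ∘ₚ composite m (λ i → σ (suc i))

    composite∈G : ∀ m σ → InG σ → G (composite m σ)
    composite∈G zero σ σ∈G = has-id
    composite∈G (suc m) σ σ∈G = closed-∘ (σ∈G 0) (composite∈G m (λ i → σ (suc i)) (λ i → σ∈G (suc i)))

    reaches-++ : ∀ Q m z rest σ → Reaches Q (play-v m z σ) rest (shift m σ) → Reaches Q z (replicate m v ++ rest) σ
    reaches-++ Q zero z rest σ r = r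
    reaches-++ Q (suc m) z rest σ r = inj₂ (reaches-++ Q m _ rest (λ i → σ (suc i)) r)

    step-∼ : ∀ g → G g → ∀ z → permute g (z + v) ∼[ ws ] permute g z + v
    step-∼ g g∈G z = ∼-+ˡ (permute g z) (v-fixed (g , g∈G))

    play-v-∼ : ∀ m z σ → InG σ → play-v m z σ ∼[ ws ] permute (composite m σ) z + m × v
    play-v-∼ zero z σ σ∈G = ≈⇒∼ (sym (identityʳ z))
    play-v-∼ (suc m) z σ σ∈G = ∼-trans (play-v-∼ m _ (λ i → σ (suc i)) (λ i → σ∈G (suc i)))
      (∼-trans (∼-+ʳ (m × v) (step-∼ B (composite∈G (suc m) σ σ∈G) z)) (≈⇒∼ (assoc (permute B z) v (m × v))))
      where B = composite (suc m) σ

    block-∼ : ∀ z σ → InG σ → play-v p z σ ∼[ ws ] permute (composite p σ) z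
    block-∼ z σ σ∈G = ∼-trans (play-v-∼ p z σ σ∈G) (≈⇒∼ (trans (∙-congˡ {Bz} (exponentⱽ v)) (identityʳ Bz)))
      where Bz = permute (composite p σ) z

    step-×-∼ : ∀ g → G g → ∀ {z} c → z ∼[ ws ] c × v → permute g (z + v) ∼[ ws ] suc c × v
    step-×-∼ g g∈G {z} c z∼cv = begin
      permute g (z + v)      ≈⟨ step-∼ g g∈G z ⟩
      permute g z + v        ≈⟨ ∼-+ʳ v (∼-invariant ws-flag (g , g∈G) z∼cv) ⟩
      permute g (c × v) + v  ≈⟨ ≈⇒∼ (∙-congʳ (φ-× (g , g∈G) c v)) ⟩
      c × permute g v + v    ≈⟨ ∼-+ʳ v (∼-× c (v-fixed (g , g∈G))) ⟩
      c × v + v              ≈⟨ ≈⇒∼ (comm (c × v) v) ⟩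
      suc c × v              ∎
      where open ≈-Reasoning ∼-setoid

    -- Starting from c v (mod W), each move of the block adds one to c, so c reaches p.
    block-reaches-W : ∀ m c {z} rest σ → InG σ → c ≤ p → p ≤ c +ℕ m → z ∼[ ws ] c × v →
                      Reaches W z (replicate m v ++ rest) σ
    block-reaches-W m c rest σ σ∈G c≤p p≤c+m z∼cv with c ≟ℕ p
    ... | yes ≡.refl = reaches-now (replicate m v ++ rest) σ (∼0⇒span (∼-trans z∼cv (≈⇒∼ (exponentⱽ v))))
    block-reaches-W zero c rest σ σ∈G c≤p p≤c+0 z∼cv | no c≢p =
      contradiction (≤-antisym c≤p (≤-trans p≤c+0 (≤-reflexive (+-identityʳ c)))) c≢p
    block-reaches-W (suc m) c rest σ σ∈G c≤p p≤c+1+m z∼cv | no c≢p =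
      inj₂ (block-reaches-W m (suc c) rest (λ i → σ (suc i)) (λ i → σ∈G (suc i)) (≤∧≢⇒< c≤p c≢p)
             (≤-trans p≤c+1+m (≤-reflexive (+-suc c m))) (step-×-∼ (σ 0) (σ∈G 0) c z∼cv))

    W′⇒block-reaches-W : ∀ {z} rest σ → InG σ → W′ z → Reaches W z (replicate p v ++ rest) σ
    W′⇒block-reaches-W rest σ σ∈G (c , z∼cv) =
      block-reaches-W p (c % p) rest σ σ∈G (<⇒≤ (m%n<n c p)) (m≤n+m p (c % p)) (∼-trans z∼cv (≈⇒∼ (×-% c v)))

    end∈W′⇒start∈W′ : ∀ z σ → InG σ → W′ (play-v p z σ) → W′ z
    end∈W′⇒start∈W′ z σ σ∈G end∈W′ =
      span-resp (v ∷ ws) (permute-flip B z)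
        (span-invariant (v-fixed ∷ ws-flag) (flip B , closed-⁻¹ (composite∈G p σ σ∈G)) Bz∈W′)
      where
      B = composite p σ
      Bz∈W′ : W′ (permute B z)
      Bz∈W′ = Congruence.span-∼ (v ∷ ws) (∼⇒∼∷ (∼-sym (block-∼ z σ σ∈G))) end∈W′

    reaches-W′-∼ : ∀ S {a b} τ → InG τ → a ∼[ ws ] b → Reaches W′ b S τ → Reaches W′ a S τ
    reaches-W′-∼ [] τ τ∈G a∼b b∈W′ = Congruence.span-∼ (v ∷ ws) (∼⇒∼∷ a∼b) b∈W′
    reaches-W′-∼ (s ∷ S) τ τ∈G a∼b (inj₁ b∈W′) = inj₁ (Congruence.span-∼ (v ∷ ws) (∼⇒∼∷ a∼b) b∈W′)
    reaches-W′-∼ (s ∷ S) τ τ∈G a∼b (inj₂ r) = inj₂ (reaches-W′-∼ S (λ i → τ (suc i)) (λ i → τ∈G (suc i))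
      (∼-invariant ws-flag (τ 0 , τ∈G 0) (∼-+ʳ s a∼b)) r)

    -- When lift v S is played against σ after its first block, blocks σ are the permutations
    -- that S sees: each is the composite of those applied at a move of S and during the next block.
    blocks : Perms → Perms
    blocks σ zero = σ 0 ∘ₚ composite p (shift 1 σ)
    blocks σ (suc i) = blocks (shift (suc p) σ) i

    blocks∈G : ∀ σ → InG σ → InG (blocks σ)
    blocks∈G σ σ∈G zero = closed-∘ (σ∈G 0) (composite∈G p (shift 1 σ) (λ i → σ∈G (1 +ℕ i)))
    blocks∈G σ σ∈G (suc i) = blocks∈G (shift (suc p) σ) (λ j → σ∈G (suc p +ℕ j)) i

    simulate : ∀ S z σ → InG σ → Reaches W′ (play-v p z σ) S (blocks (shift p σ)) → Reaches W z (lift v S) σ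
    simulate [] z σ σ∈G end∈W′ = W′⇒block-reaches-W [] σ σ∈G (end∈W′⇒start∈W′ z σ σ∈G end∈W′)
    simulate (s ∷ S) z σ σ∈G (inj₁ end∈W′) =
      W′⇒block-reaches-W _ σ σ∈G (end∈W′⇒start∈W′ z σ σ∈G end∈W′)
    simulate (s ∷ S) z σ σ∈G (inj₂ r) = reaches-++ W p z _ σ (inj₂ (simulate S z′ σ′ σ′∈G r′))
      where
      σ′ : Perms
      σ′ i = σ (p +ℕ suc i)
      σ′∈G : InG σ′
      σ′∈G i = σ∈G (p +ℕ suc i)
      z′ = permute (σ (p +ℕ 0)) (play-v p z σ + s)
      r′ : Reaches W′ (play-v p z′ σ′) S (blocks (shift p σ′))
      r′ = reaches-W′-∼ S (blocks (shift p σ′)) (blocks∈G (shift p σ′) (λ i → σ′∈G (p +ℕ i)))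
             (block-∼ z′ σ′ σ′∈G) r

    lift-wins : ∀ {S} → Wins W′ S → Wins W (lift v S)
    lift-wins {S} S-wins z σ σ∈G =
      simulate S z σ σ∈G (S-wins (play-v p z σ) (blocks (shift p σ)) (blocks∈G (shift p σ) (λ i → σ∈G (p +ℕ i))))

  liftAll : List Carrier → List Carrier → List Carrier
  liftAll [] S = S
  liftAll (v ∷ vs) S = liftAll vs (lift v S)

  liftAll-wins : ∀ {vs S} → Flag vs → Wins (InSpan vs) S → Wins (InSpan []) (liftAll vs S)
  liftAll-wins [] S-wins = S-wins
  liftAll-wins (v-fixed ∷ flag) S-wins = liftAll-wins flag (Lift.lift-wins flag v-fixed S-wins)

module WinningStrategy (r n : ℕ) {G : Permutation′ n → Set} (G-subgroup : IsSubgroup G)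
  (p-prime : Prime (suc (suc r))) {a : ℕ} {gs : List (Permutation′ n)} (|gs|≡p^a : length gs ≡ suc (suc r) ^ a)
  (G∋gs : All G gs) (gs! : AllPairs (λ g h → ¬ g ≈ₚ h) gs) (gs-complete : ∀ g → G g → Any (g ≈ₚ_) gs) where

  open import Level using (0ℓ)
  open import Algebra.Bundles using (AbelianGroup; Group)
  open import Data.Nat using (zero; _≤_; _<_; z≤n; s≤s; >-nonZero) renaming (_+_ to _+ℕ_)
  open import Data.Nat.Properties
    using (+-suc; +-comm; *-identityʳ; ≤-trans; ≤-reflexive; ≤-<-trans; <-≤-trans; <-irrefl; m≤m+n; +-monoʳ-≤)
  open import Data.Nat.Divisibility using (_∣_; ∣m+n∣m⇒∣n; ∣⇒≤)
  open import Data.Nat.DivMod using (_%_)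
  open import Data.Fin using (toℕ)
  import Data.Fin as Fin
  import Data.Fin.Properties as Fin
  open import Data.Fin.Permutation using (_⟨$⟩ʳ_)
  open import Data.List using ([]; _∷_; filter; deduplicate; allFin)
  open import Data.List.Properties using (filter-all; length-tabulate; filter-some; length-filter)
  import Data.List.Relation.Unary.All as All
  open import Data.List.Relation.Unary.All.Properties using (all-filter; ¬All⇒Any¬)
  import Data.List.Relation.Unary.Any as Any
  open import Data.List.Relation.Unary.Enumerates.Setoid using (IsEnumeration)
  open import Data.List.Relation.Unary.Enumerates.Setoid.Properties using (deduplicate⁺)
  open import Data.List.Relation.Unary.Unique.Setoid using (Unique)
  open import Data.List.Relation.Unary.Unique.Setoid.Properties using (filter⁺)
  open import Data.List.Relation.Unary.Unique.DecSetoid.Properties using (deduplicate-!)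
  open import Data.List.Relation.Unary.Unique.Propositional.Properties using (allFin⁺)
  open import Data.List.Membership.Propositional.Properties using (∈-allFin)
  open import Data.Product using (∃-syntax; proj₁; proj₂) renaming (_×_ to _∧_)
  open import Function using (_∘_)
  open import Relation.Binary.Bundles using (Setoid; DecSetoid)
  import Relation.Binary.PropositionalEquality as ≡
  import Relation.Binary.Reasoning.Setoid as ≈-Reasoning
  open import Relation.Nullary using (Dec; yes; no; contradiction)
  open import Relation.Nullary.Decidable using (map′; ¬?)
  open ListCounting
  open GroupActions
  open FunctionEnumeration
  open IntegersModulo (suc r) using (+ₘ-0-abelianGroup; toℕ-[])
  open SubgroupsOfPermutations
  open Lifting (suc r) n G-subgroup
  open Configurations (suc r) n
  open AbelianGroup V using (_-_; sym; trans; assoc; comm; ∙-congˡ; identityʳ) renaming (_∙_ to infixl 6 _+_)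
  open import Algebra.Properties.AbelianGroup V using (xyx⁻¹≈y)
  open import Algebra.Properties.CommutativeMonoid.Mult (AbelianGroup.commutativeMonoid V)
    using (_×_; ×-congˡ; ×-homo-+; ×-homo-1)
  open ModularSpans.Spans V {suc r} exponentⱽ

  -- Opaque, since unfolding the enumeration makes the type checking of later definitions very slow.
  opaque
    configs : List Carrier
    configs = functions n (allFin p)

    configs-complete : IsEnumeration setoid configs
    configs-complete = functions-complete ∈-allFin n

  module _ {ws} (ws-flag : Flag ws) where

    open Congruence ws

    quotient : DecSetoid 0ℓ 0ℓ
    quotient = record
      { isDecEquivalence = record
        { isEquivalence = Setoid.isEquivalence ∼-setoid
        ; _≟_ = λ x y → map′ mk∼ difference∈span (span? _≟_ ws (x - y)) } }

    classes : List Carrier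
    classes = deduplicate (DecSetoid._≟_ quotient) configs

    classes! : Unique ∼-setoid classes
    classes! = deduplicate-! quotient configs

    classes-complete : IsEnumeration ∼-setoid classes
    classes-complete = deduplicate⁺ quotient (Any.map ≈⇒∼ ∘ configs-complete)

    permutation-action : Action (subgroup G-subgroup) ∼-setoid
    permutation-action = record
      { _▷_ = permuteᴳ
      ; ▷-cong = λ {g} {h} {x} g≈h x∼y →
          ∼-trans (≈⇒∼ (permute-cong {proj₁ g} {proj₁ h} g≈h x)) (∼-invariant ws-flag h x∼y)
      ; ε-▷ = λ x → ≈⇒∼ (λ i → ≡.refl)
      ; ∙-▷ = λ g h x → ≈⇒∼ (λ i → ≡.refl) }

    translation-action : Carrier → Action (AbelianGroup.group +ₘ-0-abelianGroup) ∼-setoid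
    translation-action u = record
      { _▷_ = λ c x → x + toℕ c × u
      ; ▷-cong = λ { {c} ≡.refl x∼y → ∼-+ʳ (toℕ c × u) x∼y }
      ; ε-▷ = λ x → ≈⇒∼ (identityʳ x)
      ; ∙-▷ = λ c d x → ≈⇒∼ (begin
          x + toℕ (c +ₘ d) × u            ≈⟨ ∙-congˡ {x} (×-congˡ (toℕ-[] (toℕ c +ℕ toℕ d))) ⟩
          x + ((toℕ c +ℕ toℕ d) % p) × u  ≈⟨ ∙-congˡ {x} (×-% (toℕ c +ℕ toℕ d) u) ⟨
          x + (toℕ c +ℕ toℕ d) × u        ≈⟨ ∙-congˡ {x} (×-homo-+ u (toℕ c) (toℕ d)) ⟩
          x + (toℕ c × u + toℕ d × u)     ≈⟨ ∙-congˡ {x} (comm (toℕ c × u) (toℕ d × u)) ⟩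
          x + (toℕ d × u + toℕ c × u)     ≈⟨ assoc x _ _ ⟨
          x + toℕ d × u + toℕ c × u       ∎) }
      where open ≈-Reasoning setoid

    p∣#classes : ∀ {u} → ¬ InSpan ws u → p ∣ length classes
    p∣#classes {u} u∉W = ≡.subst (p ∣_) (≡.cong length (filter-all (¬? ∘ 𝔗.fixed?) {classes} (All.tabulate (λ _ → moves))))
      (𝔗.p∣#non-fixed {a = 1} p-prime |𝔽|≡p^1 classes! (λ _ _ → classes-complete _))
      where
      module 𝔗 = FixedPoints Fin._≟_ (allFin⁺ p) ∈-allFin quotient (translation-action u)
      |𝔽|≡p^1 : length (allFin p) ≡ p ^ 1
      |𝔽|≡p^1 = ≡.trans (length-tabulate (λ i → i)) (≡.sym (*-identityʳ p))
      moves : ∀ {x} → ¬ 𝔗.Fixed x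
      moves {x} x-fixed = u∉W (span-resp ws (trans (xyx⁻¹≈y x (1 × u)) (×-homo-1 u))
                                 (difference∈span (x-fixed (Fin.suc Fin.zero))))

    _≟ᴳ_ : ∀ g h → Dec (Group._≈_ (subgroup G-subgroup) g h)
    g ≟ᴳ h = Fin.all? (λ i → proj₁ g ⟨$⟩ʳ i Fin.≟ proj₁ h ⟨$⟩ʳ i)

    module 𝔊 = FixedPoints _≟ᴳ_ (toList-unique G-subgroup G∋gs gs!) (toList-complete G-subgroup G∋gs gs-complete)
                           quotient permutation-action

    #fixed : ℕ
    #fixed = length (filter 𝔊.fixed? classes)

    p∣#fixed : ∀ {u} → ¬ InSpan ws u → p ∣ #fixed
    p∣#fixed u∉W = ∣m+n∣m⇒∣n (≡.subst (p ∣_) #classes≡#non-fixed+#fixed (p∣#classes u∉W)) p∣#non-fixed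
      where
      #classes≡#non-fixed+#fixed : length classes ≡ length (filter (¬? ∘ 𝔊.fixed?) classes) +ℕ #fixed
      #classes≡#non-fixed+#fixed = ≡.trans (length-filter-∁ 𝔊.fixed? classes) (+-comm #fixed _)
      p∣#non-fixed : p ∣ length (filter (¬? ∘ 𝔊.fixed?) classes)
      p∣#non-fixed = 𝔊.p∣#non-fixed {a = a} p-prime (≡.trans (length-toList G-subgroup G∋gs) |gs|≡p^a) classes!
                                    (λ _ _ → classes-complete _)

    0<#fixed : 0 < #fixed
    0<#fixed = filter-some 𝔊.fixed? (Any.map (λ 0∼y → 𝔊.fixed-resp 0∼y 0-fixed) (classes-complete 0#))
      where
      0-fixed : 𝔊.Fixed 0#
      0-fixed g = ≈⇒∼ (λ i → ≡.refl)

    fixed-vector : ∀ {u} → ¬ InSpan ws u → ∃[ v ] ¬ InSpan ws v ∧ 𝔊.Fixed v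
    fixed-vector u∉W = v , (λ v∈W → v≁0 (span⇒∼0 v∈W)) , v-fixed
      where
      2≤#fixed : 2 ≤ #fixed
      2≤#fixed = ≤-trans (s≤s (s≤s z≤n)) (∣⇒≤ ⦃ >-nonZero 0<#fixed ⦄ (p∣#fixed u∉W))
      nonzero-fixed : Any (λ y → ¬ y ∼[ ws ] 0#) (filter 𝔊.fixed? classes)
      nonzero-fixed = Unique∧2≤length⇒∃≉ quotient (filter⁺ ∼-setoid 𝔊.fixed? classes!) 2≤#fixed 0#
      v : Carrier
      v = Any.lookup nonzero-fixed
      v-fixed : 𝔊.Fixed v
      v-fixed = proj₁ (All.lookupAny (all-filter 𝔊.fixed? classes) nonzero-fixed)
      v≁0 : ¬ v ∼[ ws ] 0#
      v≁0 = proj₂ (All.lookupAny (all-filter 𝔊.fixed? classes) nonzero-fixed)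

  #span : List Carrier → ℕ
  #span ws = length (filter (span? _≟_ ws) configs)

  #span-grows : ∀ {v} ws → ¬ InSpan ws v → #span ws < #span (v ∷ ws)
  #span-grows {v} ws v∉W = length-filter-mono-< (span? _≟_ ws) (span? _≟_ (v ∷ ws)) (span-∷ v ws)
    (Any.map (λ v≈c → span-resp (v ∷ ws) v≈c (span-head v ws) , λ c∈W → v∉W (span-resp ws (sym v≈c) c∈W))
             (configs-complete v))

  complete-flag : ∃[ ws ] Flag ws ∧ (∀ x → InSpan ws x)
  complete-flag = extend (length configs) [] (m≤m+n (length configs) (#span []))
    where
    extend : ∀ fuel {ws} → Flag ws → length configs ≤ fuel +ℕ #span ws → ∃[ ws ] Flag ws ∧ (∀ x → InSpan ws x)
    extend fuel {ws} flag bound = decide (All.all? (span? _≟_ ws) configs)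
      where
      adjoin : ∀ fuel → length configs ≤ fuel +ℕ #span ws → ∃[ v ] ¬ InSpan ws v ∧ 𝔊.Fixed flag v →
               ∃[ ws ] Flag ws ∧ (∀ x → InSpan ws x)
      adjoin zero bound (v , v∉W , _) = contradiction
        (≤-<-trans bound (<-≤-trans (#span-grows ws v∉W) (length-filter (span? _≟_ (v ∷ ws)) configs)))
        (<-irrefl ≡.refl)
      adjoin (suc fuel) bound (v , v∉W , v-fixed) = extend fuel (v-fixed ∷ flag)
        (≤-trans bound (≤-trans (≤-reflexive (≡.sym (+-suc fuel (#span ws)))) (+-monoʳ-≤ fuel (#span-grows ws v∉W))))
      decide : Dec (All (InSpan ws) configs) → ∃[ ws ] Flag ws ∧ (∀ x → InSpan ws x)
      decide (yes all-in) = ws , flag , λ x → All.lookupₛ setoid (span-resp ws) all-in (configs-complete x)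
      decide (no ¬all-in) =
        adjoin fuel bound (fixed-vector flag (proj₂ (Any.satisfied (¬All⇒Any¬ (span? _≟_ ws) configs ¬all-in))))

  can-win : CanWin n G p
  can-win = strategy complete-flag
    where
    strategy : ∃[ ws ] Flag ws ∧ (∀ x → InSpan ws x) → CanWin n G p
    strategy (ws , flag , complete) =
      liftAll ws [] , λ c σ σ∈G → reaches⇒zero (liftAll ws []) σ (liftAll-wins flag (λ c _ _ → complete c) c σ σ∈G)

lemma6p3 : (n : ℕ) → n ≥ 1 → (G : Permutation′ n → Set) → IsSubgroup G →
    (p : ℕ) → Prime p → (a : ℕ) → a ≥ 1 → HasOrder G (p ^ a) → CanWin n G p
lemma6p3 n _ G G-subgroup (suc (suc r)) p-prime a _ (gs , |gs|≡p^a , G∋gs , gs! , gs-complete) =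
  WinningStrategy.can-win r n G-subgroup p-prime {a} |gs|≡p^a G∋gs gs! gs-complete
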